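{- There exist constants $\alpha>0$ and $n_0$ such that for every integer $n\ge n_0$ and every integer $t\ge 2$, there is a set $\mathcal{T}$ of $t$ trees, all on the same label set $\mathcal{X}$ with $|\mathcal{X}|=n$, such that every leaf-disagreement for $\mathcal{T}$ has size at least $\alpha\, t\,(n-\sqrt{n})$. (That is, there are instances of AST-LR in which $\Omega(t(n-\sqrt n))$ leaves need to be deleted.)
   Context: All trees are rooted binary phylogenetic trees: rooted trees in which every non-leaf node has exactly two children, whose leaves are bijectively labeled by a finite label set $\mathcal{X}(T)$; two trees are equal if there is a label-preserving isomorphism between them. For $L\subseteq\mathcal{X}(T)$, $T-L$ is the tree obtained from $T$ by removing every leaf labeled by an element of $L$, contracting the resulting non-root vertices of degree two, and repeatedly deleting the root while it has degree one. The restriction $T|_L$ is $T-(\mathcal{X}(T)\setminus L)$. A set of trees $\{T_1,\ldots,T_t\}$ is compatible if there is a tree $T$ with $\mathcal{X}(T)=\bigcup_i\mathcal{X}(T_i)$ and $T|_{\mathcal{X}(T_i)}=T_i$ for every $i$. A list $(\mathcal{X}_1,\ldots,\mathcal{X}_t)$ of subsets of $\mathcal{X}$ is a leaf-disagreement for $\{T_1,\ldots,T_t\}$ if $\{T_1-\mathcal{X}_1,\ldots,T_t-\mathcal{X}_t\}$ is compatible; its size is $\sum_i|\mathcal{X}_i|$. -}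

module Defs where

open import Data.Nat using (ℕ; _+_; _*_; _∸_; _^_; _≤_; _≡ᵇ_)
open import Data.Bool using (Bool; true; false; not; if_then_else_)
open import Data.List using (List; []; _∷_; _++_; length; map; concatMap; allFin)
open import Data.Bool.ListAction using (any)
open import Data.Nat.ListAction using (sum)
open import Data.List.Relation.Unary.Unique.Propositional using (Unique)
open import Data.List.Relation.Binary.Subset.Propositional using (_⊆_)
open import Data.Maybe using (Maybe; just; nothing)
open import Data.Fin using (Fin)
open import Data.Product using (Σ; _×_)
open import Data.Sum using (_⊎_)

-- Rooted binary phylogenetic trees with labels in ℕ (shape only; the
-- bijective-labelling condition is the separate predicate 'Valid').
data Tree : Set where
  leaf : ℕ → Tree
  node : Tree → Tree → Tree

leaves : Tree → List ℕ
leaves (leaf x)   = x ∷ []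
leaves (node l r) = leaves l ++ leaves r

Valid : Tree → Set
Valid T = Unique (leaves T)

-- equality of trees = label-preserving isomorphism (children unordered)
data _≅_ : Tree → Tree → Set where
  leaf≅ : ∀ x → leaf x ≅ leaf x
  straight : ∀ {a b c d} → a ≅ c → b ≅ d → node a b ≅ node c d
  crossed  : ∀ {a b c d} → a ≅ d → b ≅ c → node a b ≅ node c d

-- possibly empty trees (removing all leaves yields the empty tree)
Tree? : Set
Tree? = Maybe Tree

data _≅?_ : Tree? → Tree? → Set where
  none≅ : nothing ≅? nothing
  just≅ : ∀ {a b} → a ≅ b → just a ≅? just b

leaves? : Tree? → List ℕ
leaves? nothing  = []
leaves? (just T) = leaves T

_∈ᵇ_ : ℕ → List ℕ → Bool
x ∈ᵇ L = any (x ≡ᵇ_) L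

-- keep the leaves satisfying 'keep', delete the others, suppress the
-- resulting degree-two vertices and repeatedly delete a degree-one root
prune : (ℕ → Bool) → Tree → Tree?
prune keep (leaf x) = if keep x then just (leaf x) else nothing
prune keep (node l r) with prune keep l | prune keep r
... | just a  | just b  = just (node a b)
... | just a  | nothing = just a
... | nothing | just b  = just b
... | nothing | nothing = nothing

prune? : (ℕ → Bool) → Tree? → Tree?
prune? keep nothing  = nothing
prune? keep (just T) = prune keep T

_─_ : Tree → List ℕ → Tree?
T ─ L = prune (λ x → not (x ∈ᵇ L)) T

_∣_ : Tree? → List ℕ → Tree?
T ∣ L = prune? (λ x → x ∈ᵇ L) T

labelUnion : ∀ {t} → (Fin t → Tree?) → List ℕ
labelUnion {t} Ts = concatMap (λ i → leaves? (Ts i)) (allFin t)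

Compatible : ∀ {t} → (Fin t → Tree?) → Set
Compatible {t} Ts =
  Σ Tree? λ S →
    Unique (leaves? S) ×
    (leaves? S ⊆ labelUnion Ts) × (labelUnion Ts ⊆ leaves? S) ×
    (∀ i → (S ∣ leaves? (Ts i)) ≅? Ts i)

IsLeafDisagreement : ∀ {t} → List ℕ → (Fin t → Tree) → (Fin t → List ℕ) → Set
IsLeafDisagreement X Ts Xs =
  (∀ i → Unique (Xs i) × Xs i ⊆ X) × Compatible (λ i → Ts i ─ Xs i)

size : ∀ {t} → (Fin t → List ℕ) → ℕ
size {t} Xs = sum (map (λ i → length (Xs i)) (allFin t))

-- s ≥ (p/q)·t·(n - √n), stated without reals:
-- q·s + p·t·√n ≥ p·t·n  ⇔  (p·t·n ∸ q·s)² ≤ (p·t)²·n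
AtLeastBound : (p q t n s : ℕ) → Set
AtLeastBound p q t n s = ((p * t * n) ∸ (q * s)) ^ 2 ≤ (p * t) ^ 2 * n

module Submission where

-- On the labels 0,…,n-1 alternate the ascending caterpillar (0 nearest the
-- root) and the descending one (n-1 nearest the root).  For x < y < z the
-- first displays the rooted triplet yz|x, the second xy|z.  A triplet that a
-- tree Tᵢ displays on labels kept in Tᵢ - Xᵢ is displayed by every
-- compatible supertree (pruning, isomorphism and restriction preserve
-- displayed triplets), and no tree with distinct leaves displays both yz|x
-- and xy|z.  So an ascending tree i and a descending tree j share at most
-- two surviving labels: |Xᵢ| + |Xⱼ| ≥ n - 2.  Pairing the trees (0,1),
-- (2,3), … gives size ≥ ⌊t/2⌋(n - 2), which yields 3·size + t·√n ≥ t·n.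

open import Defs
open import Data.Nat using (ℕ; zero; suc; _+_; _*_; _^_; _≤_; _<_; _>_; _≡ᵇ_; z≤n; s≤s; ⌊_/2⌋; ⌈_/2⌉; _≟_)
open import Data.Nat.Properties
open import Data.Nat.ListAction using (sum)
open import Data.Nat.Tactic.RingSolver using (solve-∀)
open import Data.Bool using (Bool; true; false; not; if_then_else_) renaming (T to True)
open import Data.Bool.Properties using (T?)
open import Data.Fin using (Fin) renaming (zero to fzero; suc to fsuc)
open import Data.List using (List; []; _∷_; _++_; length; filter; filterᵇ; tabulate; applyUpTo; upTo; downFrom)
open import Data.List.Properties using (filter-++; ++-identityʳ; length-++; length-upTo; map-tabulate; reverse-downFrom)
open import Data.List.Relation.Unary.Any as Any using (here; there)
open import Data.List.Relation.Unary.Any.Properties using (any⁺; any⁻)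
open import Data.List.Relation.Unary.All as All using (All)
open import Data.List.Relation.Unary.All.Properties as AllProps using ()
open import Data.List.Relation.Unary.AllPairs as AllPairs using (AllPairs; _∷_)
open import Data.List.Relation.Unary.AllPairs.Properties as AllPairsProps using ()
open import Data.List.Relation.Unary.Unique.Propositional using (Unique)
open import Data.List.Membership.Propositional using (_∈_; _∉_)
open import Data.List.Membership.Propositional.Properties using (∈-filter⁺; ∈-filter⁻; ∈-++⁺ˡ; ∈-++⁺ʳ; ∈-++⁻; ∈-∃++; ∈-upTo⁺; ∈-upTo⁻; ∈-downFrom⁺)
open import Data.List.Membership.DecPropositional _≟_ using (_∈?_; _∉?_)
open import Data.List.Relation.Binary.Subset.Propositional using (_⊆_)
open import Data.List.Relation.Binary.Permutation.Propositional using (_↭_; ↭-refl; ↭-sym; ↭-trans; ↭-reflexive)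
open import Data.List.Relation.Binary.Permutation.Propositional.Properties using (∈-resp-↭; ++⁺; ++-comm; shift; ↭-length; ↭-reverse)
open import Data.Maybe using (just; nothing)
open import Data.Product using (Σ; _×_; _,_; proj₁; proj₂)
open import Data.Sum using (_⊎_; inj₁; inj₂)
open import Data.Empty using (⊥; ⊥-elim)
open import Data.Unit using (tt)
open import Function using (_∘_; id)
open import Relation.Nullary using (yes; no)
open import Relation.Binary.Core using (Rel)
open import Relation.Binary.Definitions using (Asymmetric)
open import Relation.Binary.PropositionalEquality using (_≡_; _≢_; refl; sym; cong; cong₂; subst; module ≡-Reasoning)

∈ᵇ⇒∈ : ∀ {x L} → True (x ∈ᵇ L) → x ∈ L
∈ᵇ⇒∈ {x} {L} p = Any.map (≡ᵇ⇒≡ x _) (any⁻ (x ≡ᵇ_) L p)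

∈⇒∈ᵇ : ∀ {x L} → x ∈ L → True (x ∈ᵇ L)
∈⇒∈ᵇ {x} p = any⁺ (x ≡ᵇ_) (Any.map (≡⇒≡ᵇ x _) p)

∉⇒kept : ∀ {x L} → x ∉ L → True (not (x ∈ᵇ L))
∉⇒kept {x} {L} x∉ with x ∈ᵇ L in eq
... | true  = ⊥-elim (x∉ (∈ᵇ⇒∈ (subst True (sym eq) tt)))
... | false = tt

graft : Tree? → Tree? → Tree?
graft (just a) (just b) = just (node a b)
graft (just a) nothing  = just a
graft nothing  Q        = Q

prune-node : ∀ keep l r → prune keep (node l r) ≡ graft (prune keep l) (prune keep r)
prune-node keep l r with prune keep l | prune keep r
... | just a  | just b  = refl
... | just a  | nothing = refl
... | nothing | just b  = refl
... | nothing | nothing = refl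

leaves-graft : ∀ P Q → leaves? (graft P Q) ≡ leaves? P ++ leaves? Q
leaves-graft (just a) (just b) = refl
leaves-graft (just a) nothing  = sym (++-identityʳ (leaves a))
leaves-graft nothing  Q        = refl

leaves-prune : ∀ keep U → leaves? (prune keep U) ≡ filterᵇ keep (leaves U)
leaves-prune keep (leaf x) with keep x
... | true  = refl
... | false = refl
leaves-prune keep (node l r) = begin
  leaves? (prune keep (node l r))                    ≡⟨ cong leaves? (prune-node keep l r) ⟩
  leaves? (graft (prune keep l) (prune keep r))      ≡⟨ leaves-graft (prune keep l) (prune keep r) ⟩
  leaves? (prune keep l) ++ leaves? (prune keep r)   ≡⟨ cong₂ _++_ (leaves-prune keep l) (leaves-prune keep r) ⟩
  filterᵇ keep (leaves l) ++ filterᵇ keep (leaves r) ≡⟨ filter-++ (T? ∘ keep) (leaves l) (leaves r) ⟨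
  filterᵇ keep (leaves (node l r))                   ∎
  where open ≡-Reasoning

∈-prune⁺ : ∀ {keep x} U → True (keep x) → x ∈ leaves U → x ∈ leaves? (prune keep U)
∈-prune⁺ {keep} U kx x∈ = subst (_ ∈_) (sym (leaves-prune keep U)) (∈-filter⁺ (T? ∘ keep) x∈ kx)

∈-prune⁻ : ∀ {keep x} U → x ∈ leaves? (prune keep U) → x ∈ leaves U × True (keep x)
∈-prune⁻ {keep} U x∈ = ∈-filter⁻ (T? ∘ keep) (subst (_ ∈_) (leaves-prune keep U) x∈)

Splits : ℕ → ℕ → ℕ → List ℕ → Set
Splits a b c L = a ∈ L × b ∈ L × c ∉ L

-- Some subtree of the tree has a cluster separating a, b from c; for leaves
-- a, b, c of the tree this says it displays the rooted triplet ab|c.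
data Displays (a b c : ℕ) : Tree → Set where
  here  : ∀ {U} → Splits a b c (leaves U) → Displays a b c U
  left  : ∀ {l r} → Displays a b c l → Displays a b c (node l r)
  right : ∀ {l r} → Displays a b c r → Displays a b c (node l r)

Displays? : ℕ → ℕ → ℕ → Tree? → Set
Displays? a b c nothing  = ⊥
Displays? a b c (just U) = Displays a b c U

displays-∈ : ∀ {a b c U} → Displays a b c U → a ∈ leaves U × b ∈ leaves U
displays-∈ (here (a∈ , b∈ , _))   = a∈ , b∈
displays-∈ {U = node l r} (left d)  = ∈-++⁺ˡ (proj₁ (displays-∈ d)) , ∈-++⁺ˡ (proj₂ (displays-∈ d))
displays-∈ {U = node l r} (right d) = ∈-++⁺ʳ (leaves l) (proj₁ (displays-∈ d)) , ∈-++⁺ʳ (leaves l) (proj₂ (displays-∈ d))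

splits-↭ : ∀ {a b c L M} → L ↭ M → Splits a b c L → Splits a b c M
splits-↭ L↭M (a∈ , b∈ , c∉) = ∈-resp-↭ L↭M a∈ , ∈-resp-↭ L↭M b∈ , c∉ ∘ ∈-resp-↭ (↭-sym L↭M)

≅⇒↭ : ∀ {U V} → U ≅ V → leaves U ↭ leaves V
≅⇒↭ (leaf≅ x)      = ↭-refl
≅⇒↭ (straight p q) = ++⁺ (≅⇒↭ p) (≅⇒↭ q)
≅⇒↭ (crossed {c = c} {d} p q) = ↭-trans (++⁺ (≅⇒↭ p) (≅⇒↭ q)) (++-comm (leaves d) (leaves c))

displays-≅ : ∀ {a b c U V} → U ≅ V → Displays a b c V → Displays a b c U
displays-≅ iso            (here s)  = here (splits-↭ (↭-sym (≅⇒↭ iso)) s)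
displays-≅ (straight p q) (left d)  = left (displays-≅ p d)
displays-≅ (straight p q) (right d) = right (displays-≅ q d)
displays-≅ (crossed p q)  (left d)  = right (displays-≅ q d)
displays-≅ (crossed p q)  (right d) = left (displays-≅ p d)

displays?-≅? : ∀ {a b c P Q} → P ≅? Q → Displays? a b c Q → Displays? a b c P
displays?-≅? none≅        ()
displays?-≅? (just≅ iso) d = displays-≅ iso d

graft-displaysˡ : ∀ {a b c} P Q → Displays? a b c P → Displays? a b c (graft P Q)
graft-displaysˡ (just u) (just v) d = left d
graft-displaysˡ (just u) nothing  d = d
graft-displaysˡ nothing  Q        ()

graft-displaysʳ : ∀ {a b c} P Q → Displays? a b c Q → Displays? a b c (graft P Q)
graft-displaysʳ (just u) (just v) d = right d
graft-displaysʳ (just u) nothing  ()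
graft-displaysʳ nothing  Q        d = d

graft-displays⁻ : ∀ {a b c} P Q → Displays? a b c (graft P Q) →
  Splits a b c (leaves? (graft P Q)) ⊎ Displays? a b c P ⊎ Displays? a b c Q
graft-displays⁻ (just u) (just v) (here s)  = inj₁ s
graft-displays⁻ (just u) (just v) (left d)  = inj₂ (inj₁ d)
graft-displays⁻ (just u) (just v) (right d) = inj₂ (inj₂ d)
graft-displays⁻ (just u) nothing  d         = inj₂ (inj₁ d)
graft-displays⁻ nothing  Q        d         = inj₂ (inj₂ d)

displays-prune⁺ : ∀ {keep a b c U} → Displays a b c U → True (keep a) → True (keep b) →
  Displays? a b c (prune keep U)
displays-prune⁺ {keep} {a} {b} {c} {U} (here (a∈ , b∈ , c∉)) ka kb =
  splits⇒displays? (prune keep U) (∈-prune⁺ U ka a∈ , ∈-prune⁺ U kb b∈ , c∉ ∘ proj₁ ∘ ∈-prune⁻ U)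
  where
  splits⇒displays? : ∀ P → Splits a b c (leaves? P) → Displays? a b c P
  splits⇒displays? nothing  (() , _)
  splits⇒displays? (just V) s = here s
displays-prune⁺ {keep} {a} {b} {c} (left {l} {r} d) ka kb =
  subst (Displays? a b c) (sym (prune-node keep l r))
    (graft-displaysˡ (prune keep l) (prune keep r) (displays-prune⁺ d ka kb))
displays-prune⁺ {keep} {a} {b} {c} (right {l} {r} d) ka kb =
  subst (Displays? a b c) (sym (prune-node keep l r))
    (graft-displaysʳ (prune keep l) (prune keep r) (displays-prune⁺ d ka kb))

displays-prune⁻ : ∀ {keep a b c} U → True (keep c) → Displays? a b c (prune keep U) → Displays a b c U
displays-prune⁻ {keep} (leaf x) kc d with keep x
... | true  = d
... | false = ⊥-elim d
displays-prune⁻ {keep} {a} {b} {c} (node l r) kc d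
  with graft-displays⁻ (prune keep l) (prune keep r) (subst (Displays? a b c) (prune-node keep l r) d)
... | inj₁ s        = here (unprune (subst (λ P → Splits a b c (leaves? P)) (sym (prune-node keep l r)) s))
  where
  unprune : Splits a b c (leaves? (prune keep (node l r))) → Splits a b c (leaves (node l r))
  unprune (a∈ , b∈ , c∉) = proj₁ (∈-prune⁻ (node l r) a∈) , proj₁ (∈-prune⁻ (node l r) b∈) ,
                           c∉ ∘ ∈-prune⁺ (node l r) kc
... | inj₂ (inj₁ d′) = left (displays-prune⁻ l kc d′)
... | inj₂ (inj₂ d′) = right (displays-prune⁻ r kc d′)

supertree-displays : ∀ {a b c} S U X → (S ∣ leaves? (U ─ X)) ≅? (U ─ X) →
  Displays a b c U → a ∉ X → b ∉ X → c ∉ X → c ∈ leaves U → Displays? a b c S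
supertree-displays {a} {b} {c} S U X restricts d a∉ b∉ c∉ c∈ =
  unrestrict S (displays?-≅? restricts (displays-prune⁺ d (∉⇒kept a∉) (∉⇒kept b∉)))
  where
  c-survives : c ∈ leaves? (U ─ X)
  c-survives = ∈-prune⁺ U (∉⇒kept c∉) c∈
  unrestrict : ∀ S → Displays? a b c (S ∣ leaves? (U ─ X)) → Displays? a b c S
  unrestrict nothing  ()
  unrestrict (just V) d′ = displays-prune⁻ V (∈⇒∈ᵇ c-survives) d′

unique-++⁻ : ∀ (xs : List ℕ) {ys} → Unique (xs ++ ys) →
  Unique xs × Unique ys × (∀ {v} → v ∈ xs → v ∉ ys)
unique-++⁻ []       u             = AllPairs.[] , u , λ ()
unique-++⁻ (x ∷ xs) (x∉rest ∷ u) with unique-++⁻ xs u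
... | uxs , uys , disjoint =
  AllProps.++⁻ˡ xs x∉rest ∷ uxs , uys ,
  λ { (here refl) v∈ys → All.lookup (AllProps.++⁻ʳ xs x∉rest) v∈ys refl
    ; (there v∈xs)    → disjoint v∈xs }

triplet-conflict : ∀ {x y z} U → Unique (leaves U) → Displays y z x U → Displays x y z U → ⊥
triplet-conflict U u (here (_ , _ , x∉)) e = x∉ (proj₁ (displays-∈ e))
triplet-conflict U u d (here (_ , _ , z∉)) = z∉ (proj₂ (displays-∈ d))
triplet-conflict (node l r) u (left d) (left e) =
  triplet-conflict l (proj₁ (unique-++⁻ (leaves l) u)) d e
triplet-conflict (node l r) u (right d) (right e) =
  triplet-conflict r (proj₁ (proj₂ (unique-++⁻ (leaves l) u))) d e
triplet-conflict (node l r) u (left d) (right e) =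
  proj₂ (proj₂ (unique-++⁻ (leaves l) u)) (proj₁ (displays-∈ d)) (proj₂ (displays-∈ e))
triplet-conflict (node l r) u (right d) (left e) =
  proj₂ (proj₂ (unique-++⁻ (leaves l) u)) (proj₂ (displays-∈ e)) (proj₁ (displays-∈ d))

triplet-conflict? : ∀ {x y z} S → Unique (leaves? S) → Displays? y z x S → Displays? x y z S → ⊥
triplet-conflict? nothing  _ ()
triplet-conflict? (just U) u d e = triplet-conflict U u d e

caterpillar : ℕ → List ℕ → Tree
caterpillar w []       = leaf w
caterpillar w (v ∷ vs) = node (leaf w) (caterpillar v vs)

leaves-caterpillar : ∀ w ws → leaves (caterpillar w ws) ≡ w ∷ ws
leaves-caterpillar w []       = refl
leaves-caterpillar w (v ∷ vs) = cong (w ∷_) (leaves-caterpillar v vs)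

avoid-head : ∀ {ℓ} {R : Rel ℕ ℓ} → Asymmetric R → ∀ {w ws a b} → All (R w) ws →
  a ∈ w ∷ ws → R a b → b ∈ w ∷ ws → b ∈ ws
avoid-head asym Rw a∈         Rab (there b∈) = b∈
avoid-head asym Rw (here refl) Rab (here refl) = ⊥-elim (asym Rab Rab)
avoid-head asym Rw (there a∈) Rab (here refl) = ⊥-elim (asym Rab (All.lookup Rw a∈))

caterpillar-displays : ∀ {ℓ} {R : Rel ℕ ℓ} → Asymmetric R → ∀ w ws → AllPairs R (w ∷ ws) →
  ∀ {a b c} → a ∈ w ∷ ws → b ∈ w ∷ ws → c ∈ w ∷ ws → R a b → R a c → Displays b c a (caterpillar w ws)
caterpillar-displays asym w [] (Rw ∷ _) a∈ b∈ c∈ Rab Rac with avoid-head asym Rw a∈ Rab b∈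
... | ()
caterpillar-displays asym w (v ∷ vs) (Rw ∷ _) (here refl) b∈ c∈ Rab Rac =
  right (here (subst (Splits _ _ w) (sym (leaves-caterpillar v vs))
    (avoid-head asym Rw (here refl) Rab b∈ , avoid-head asym Rw (here refl) Rac c∈ , w-fresh)))
  where
  w-fresh : w ∉ v ∷ vs
  w-fresh w∈ = asym (All.lookup Rw w∈) (All.lookup Rw w∈)
caterpillar-displays asym w (v ∷ vs) (Rw ∷ sorted) (there a∈) b∈ c∈ Rab Rac =
  right (caterpillar-displays asym v vs sorted a∈
    (avoid-head asym Rw (there a∈) Rab b∈) (avoid-head asym Rw (there a∈) Rac c∈) Rab Rac)

ascending : ℕ → Tree
ascending m = caterpillar 0 (applyUpTo suc m)

descending : ℕ → Tree
descending m = caterpillar m (downFrom m)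

upTo-sorted : ∀ n → AllPairs _<_ (upTo n)
upTo-sorted n = AllPairsProps.applyUpTo⁺₁ id n (λ i<j _ → i<j)

downFrom-sorted : ∀ n → AllPairs _>_ (downFrom n)
downFrom-sorted n = AllPairsProps.applyDownFrom⁺₁ id n (λ j<i _ → j<i)

unique-upTo : ∀ n → Unique (upTo n)
unique-upTo n = AllPairs.map <⇒≢ (upTo-sorted n)

leaves-ascending : ∀ m → leaves (ascending m) ≡ upTo (suc m)
leaves-ascending m = leaves-caterpillar 0 (applyUpTo suc m)

leaves-descending : ∀ m → leaves (descending m) ≡ downFrom (suc m)
leaves-descending m = leaves-caterpillar m (downFrom m)

downFrom↭upTo : ∀ n → downFrom n ↭ upTo n
downFrom↭upTo n = ↭-trans (↭-sym (↭-reverse (downFrom n))) (↭-reflexive (reverse-downFrom n))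

⊆-delete : ∀ {x : ℕ} {xs} as bs → All (x ≢_) xs → xs ⊆ as ++ x ∷ bs → xs ⊆ as ++ bs
⊆-delete as bs x∉xs sub v∈ with ∈-++⁻ as (sub v∈)
... | inj₁ v∈as          = ∈-++⁺ˡ v∈as
... | inj₂ (here refl)   = ⊥-elim (All.lookup x∉xs v∈ refl)
... | inj₂ (there v∈bs)  = ∈-++⁺ʳ as v∈bs

unique-⊆-length : ∀ {xs ys : List ℕ} → Unique xs → xs ⊆ ys → length xs ≤ length ys
unique-⊆-length {[]}     _             _   = z≤n
unique-⊆-length {x ∷ xs} (x∉xs ∷ u) sub with as , bs , refl ← ∈-∃++ (sub (here refl)) = begin
  suc (length xs)         ≤⟨ s≤s (unique-⊆-length u (⊆-delete as bs x∉xs (sub ∘ there))) ⟩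
  suc (length (as ++ bs)) ≡⟨ ↭-length (shift x as bs) ⟨
  length (as ++ x ∷ bs)   ∎
  where open ≤-Reasoning

cover-length : ∀ D {X} → Unique X → length X ≤ length D + length (filter (_∉? D) X)
cover-length D {X} u = begin
  length X                               ≤⟨ unique-⊆-length u covered ⟩
  length (D ++ filter (_∉? D) X)         ≡⟨ length-++ D ⟩
  length D + length (filter (_∉? D) X)   ∎
  where
  open ≤-Reasoning
  covered : X ⊆ D ++ filter (_∉? D) X
  covered {x} x∈ with x ∈? D
  ... | yes x∈D = ∈-++⁺ˡ x∈D
  ... | no  x∉D = ∈-++⁺ʳ D (∈-filter⁺ (_∉? D) x∈ x∉D)

no-triple⇒length≤2 : ∀ {L} → AllPairs _<_ L →
  (∀ {x y z} → x ∈ L → y ∈ L → z ∈ L → x < y → y < z → ⊥) → length L ≤ 2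
no-triple⇒length≤2 {[]}             _ _ = z≤n
no-triple⇒length≤2 {_ ∷ []}         _ _ = s≤s z≤n
no-triple⇒length≤2 {_ ∷ _ ∷ []}     _ _ = s≤s (s≤s z≤n)
no-triple⇒length≤2 {_ ∷ _ ∷ _ ∷ _} ((x<y All.∷ _) ∷ (y<z All.∷ _) ∷ _) no-triple =
  ⊥-elim (no-triple (here refl) (there (here refl)) (there (there (here refl))) x<y y<z)

-- If the trees of a compatible family after deletion include an ascending
-- tree i and a descending tree j on 0,…,m, then all but two labels are
-- deleted from Tᵢ or from Tⱼ: a surviving triple x < y < z would make the
-- supertree display both yz|x and xy|z.
pair-bound : ∀ m {t} (Ts : Fin t → Tree) (Xs : Fin t → List ℕ) → Compatible (λ i → Ts i ─ Xs i) →
  ∀ i j → Ts i ≡ ascending m → Ts j ≡ descending m → suc m ≤ length (Xs i) + length (Xs j) + 2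
pair-bound m Ts Xs (S , unique-S , _ , _ , restricts) i j asc desc = begin
  suc m                               ≡⟨ length-upTo (suc m) ⟨
  length (upTo (suc m))               ≤⟨ cover-length D (unique-upTo (suc m)) ⟩
  length D + length survivors         ≤⟨ +-mono-≤ (≤-reflexive (length-++ (Xs i))) (no-triple⇒length≤2 sorted no-triple) ⟩
  length (Xs i) + length (Xs j) + 2   ∎
  where
  open ≤-Reasoning
  D = Xs i ++ Xs j
  survivors = filter (_∉? D) (upTo (suc m))

  sorted : AllPairs _<_ survivors
  sorted = AllPairsProps.filter⁺ (_∉? D) (upTo-sorted (suc m))

  restricts-to : ∀ k U → Ts k ≡ U → (S ∣ leaves? (U ─ Xs k)) ≅? (U ─ Xs k)
  restricts-to k U eq = subst (λ V → (S ∣ leaves? (V ─ Xs k)) ≅? (V ─ Xs k)) eq (restricts k)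

  survives : ∀ {x} → x ∈ survivors → x < suc m × x ∉ Xs i × x ∉ Xs j
  survives x∈ with ∈-filter⁻ (_∉? D) x∈
  ... | x∈X , x∉D = ∈-upTo⁻ x∈X , x∉D ∘ ∈-++⁺ˡ , x∉D ∘ ∈-++⁺ʳ (Xs i)

  no-triple : ∀ {x y z} → x ∈ survivors → y ∈ survivors → z ∈ survivors → x < y → y < z → ⊥
  no-triple x∈ y∈ z∈ x<y y<z with survives x∈ | survives y∈ | survives z∈
  ... | x<n , x∉i , x∉j | y<n , y∉i , y∉j | z<n , z∉i , z∉j =
    triplet-conflict? S unique-S
      (supertree-displays S (ascending m) (Xs i) (restricts-to i _ asc)
        (caterpillar-displays <-asym 0 (applyUpTo suc m) (upTo-sorted (suc m))
          (∈-upTo⁺ x<n) (∈-upTo⁺ y<n) (∈-upTo⁺ z<n) x<y (<-trans x<y y<z))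
        y∉i z∉i x∉i (subst (_ ∈_) (sym (leaves-ascending m)) (∈-upTo⁺ x<n)))
      (supertree-displays S (descending m) (Xs j) (restricts-to j _ desc)
        (caterpillar-displays <-asym m (downFrom m) (downFrom-sorted (suc m))
          (∈-downFrom⁺ z<n) (∈-downFrom⁺ x<n) (∈-downFrom⁺ y<n) (<-trans x<y y<z) y<z)
        x∉j y∉j z∉j (subst (_ ∈_) (sym (leaves-descending m)) (∈-downFrom⁺ z<n)))

evenPosition : ∀ {t} → Fin t → Bool
evenPosition fzero               = true
evenPosition (fsuc fzero)        = false
evenPosition (fsuc (fsuc i))     = evenPosition i

pairing-bound : ∀ {m c} t (g : Fin t → ℕ) →
  (∀ i j → evenPosition i ≡ true → evenPosition j ≡ false → m ≤ g i + g j + c) →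
  ⌊ t /2⌋ * m ≤ sum (tabulate g) + ⌊ t /2⌋ * c
pairing-bound zero                _ _     = z≤n
pairing-bound (suc zero)          _ _     = z≤n
pairing-bound {m} {c} (suc (suc t)) g pairs = begin
  m + ⌊ t /2⌋ * m                                          ≤⟨ +-mono-≤ first-pair rest ⟩
  g fzero + g (fsuc fzero) + c + (sum (tabulate g′) + ⌊ t /2⌋ * c) ≡⟨ regroup (g fzero) (g (fsuc fzero)) c _ _ ⟩
  g fzero + (g (fsuc fzero) + sum (tabulate g′)) + (c + ⌊ t /2⌋ * c) ∎
  where
  open ≤-Reasoning
  g′ : Fin t → ℕ
  g′ = g ∘ fsuc ∘ fsuc
  first-pair : m ≤ g fzero + g (fsuc fzero) + c
  first-pair = pairs fzero (fsuc fzero) refl refl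
  rest : ⌊ t /2⌋ * m ≤ sum (tabulate g′) + ⌊ t /2⌋ * c
  rest = pairing-bound t g′ (λ i j → pairs (fsuc (fsuc i)) (fsuc (fsuc j)))
  regroup : ∀ a b c s h → a + b + c + (s + h) ≡ a + (b + s) + (c + h)
  regroup = solve-∀

size-tabulate : ∀ {t} (Xs : Fin t → List ℕ) → size Xs ≡ sum (tabulate (λ i → length (Xs i)))
size-tabulate Xs = cong sum (map-tabulate id (λ i → length (Xs i)))

t≤3⌊t/2⌋ : ∀ t → 2 ≤ t → t ≤ 3 * ⌊ t /2⌋
t≤3⌊t/2⌋ 1 (s≤s ())
t≤3⌊t/2⌋ 2 _ = s≤s (s≤s z≤n)
t≤3⌊t/2⌋ 3 _ = ≤-refl
t≤3⌊t/2⌋ (suc (suc t@(suc (suc _)))) _ = begin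
  2 + t               ≤⟨ +-monoʳ-≤ 2 (t≤3⌊t/2⌋ t (s≤s (s≤s z≤n))) ⟩
  2 + 3 * ⌊ t /2⌋     ≤⟨ n≤1+n _ ⟩
  3 + 3 * ⌊ t /2⌋     ≡⟨ *-suc 3 ⌊ t /2⌋ ⟨
  3 * suc ⌊ t /2⌋     ∎
  where open ≤-Reasoning

2⌊t/2⌋≤t : ∀ t → 2 * ⌊ t /2⌋ ≤ t
2⌊t/2⌋≤t t = begin
  2 * ⌊ t /2⌋           ≡⟨ cong (⌊ t /2⌋ +_) (+-identityʳ ⌊ t /2⌋) ⟩
  ⌊ t /2⌋ + ⌊ t /2⌋     ≤⟨ +-monoʳ-≤ ⌊ t /2⌋ (⌊n/2⌋≤⌈n/2⌉ t) ⟩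
  ⌊ t /2⌋ + ⌈ t /2⌉     ≡⟨ ⌊n/2⌋+⌈n/2⌉≡n t ⟩
  t                     ∎
  where open ≤-Reasoning

atLeastBound-intro : ∀ p q t n s d → p * t * n ≤ q * s + d → d ^ 2 ≤ (p * t) ^ 2 * n →
  AtLeastBound p q t n s
atLeastBound-intro p q t n s d gap slack =
  ≤-trans (^-monoˡ-≤ 2 (m≤n+o⇒m∸n≤o (p * t * n) (q * s) gap)) slack

-- From ⌊t/2⌋(n - 2) ≤ s: t·n ≤ 3s + 3t, and the slack 3t is at most t·√n for n ≥ 9.
third-bound : ∀ t n s → 2 ≤ t → 9 ≤ n → ⌊ t /2⌋ * n ≤ s + ⌊ t /2⌋ * 2 → AtLeastBound 1 3 t n s
third-bound t n s 2≤t 9≤n paired = atLeastBound-intro 1 3 t n s (3 * t) gap slack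
  where
  h = ⌊ t /2⌋
  gap : 1 * t * n ≤ 3 * s + 3 * t
  gap = begin
    1 * t * n           ≡⟨ cong (_* n) (*-identityˡ t) ⟩
    t * n               ≤⟨ *-monoˡ-≤ n (t≤3⌊t/2⌋ t 2≤t) ⟩
    3 * h * n           ≡⟨ *-assoc 3 h n ⟩
    3 * (h * n)         ≤⟨ *-monoʳ-≤ 3 paired ⟩
    3 * (s + h * 2)     ≡⟨ distribute s h ⟩
    3 * s + 3 * (2 * h) ≤⟨ +-monoʳ-≤ (3 * s) (*-monoʳ-≤ 3 (2⌊t/2⌋≤t t)) ⟩
    3 * s + 3 * t       ∎
    where
    open ≤-Reasoning
    distribute : ∀ s h → 3 * (s + h * 2) ≡ 3 * s + 3 * (2 * h)
    distribute = solve-∀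
  slack : (3 * t) ^ 2 ≤ (1 * t) ^ 2 * n
  slack = begin
    (3 * t) ^ 2         ≡⟨ square t ⟩
    (1 * t) ^ 2 * 9     ≤⟨ *-monoʳ-≤ ((1 * t) ^ 2) 9≤n ⟩
    (1 * t) ^ 2 * n     ∎
    where
    open ≤-Reasoning
    -- (3t)² = t²·9, with the squares unfolded so that the ring solver applies
    square : ∀ u → (3 * u) * ((3 * u) * 1) ≡ ((1 * u) * ((1 * u) * 1)) * 9
    square = solve-∀

alternating : ∀ m {t} → Fin t → Tree
alternating m i = if evenPosition i then ascending m else descending m

alternating-leaves : ∀ m {t} (i : Fin t) → leaves (alternating m i) ↭ upTo (suc m)
alternating-leaves m i with evenPosition i
... | true  = ↭-reflexive (leaves-ascending m)
... | false = ↭-trans (↭-reflexive (leaves-descending m)) (downFrom↭upTo (suc m))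

alternating-bound : ∀ m t (Xs : Fin t → List ℕ) → IsLeafDisagreement (upTo (suc m)) (alternating m) Xs →
  ⌊ t /2⌋ * suc m ≤ size Xs + ⌊ t /2⌋ * 2
alternating-bound m t Xs (_ , compatible) =
  subst (λ s → ⌊ t /2⌋ * suc m ≤ s + ⌊ t /2⌋ * 2) (sym (size-tabulate Xs))
    (pairing-bound t (λ i → length (Xs i)) pair)
  where
  pair : ∀ i j → evenPosition i ≡ true → evenPosition j ≡ false → suc m ≤ length (Xs i) + length (Xs j) + 2
  pair i j even odd = pair-bound m (alternating m) Xs compatible i j
    (cong (if_then ascending m else descending m) even) (cong (if_then ascending m else descending m) odd)

corollary1 : Σ ℕ λ p → Σ ℕ λ q → 0 < p × 0 < q × Σ ℕ λ n₀ →
    ∀ n t → n₀ ≤ n → 2 ≤ t →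
    Σ (Fin t → Tree) λ Ts → Σ (List ℕ) λ X →
      Unique X × length X ≡ n × (∀ i → leaves (Ts i) ↭ X) ×
      (∀ (Xs : Fin t → List ℕ) → IsLeafDisagreement X Ts Xs →
         AtLeastBound p q t n (size Xs))
corollary1 = 1 , 3 , s≤s z≤n , s≤s z≤n , 9 , instance-on
  where
  instance-on : ∀ n t → 9 ≤ n → 2 ≤ t →
    Σ (Fin t → Tree) λ Ts → Σ (List ℕ) λ X →
      Unique X × length X ≡ n × (∀ i → leaves (Ts i) ↭ X) ×
      (∀ (Xs : Fin t → List ℕ) → IsLeafDisagreement X Ts Xs → AtLeastBound 1 3 t n (size Xs))
  instance-on (suc m) t 9≤n 2≤t =
    alternating m , upTo (suc m) , unique-upTo (suc m) , length-upTo (suc m) , alternating-leaves m ,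
    λ Xs disagreement → third-bound t (suc m) (size Xs) 2≤t 9≤n (alternating-bound m t Xs disagreement)
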